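{- Let $m,n\ge 4$ both be even and let $G=C_m\times C_n$ be the torus grid graph, i.e. the graph with vertex set $\{(i,j): 0\le i\le m-1,\ 0\le j\le n-1\}$ in which $(i,j)$ and $(i',j')$ are adjacent iff either $i=i'$ and $j-j'\equiv\pm1\pmod n$, or $j=j'$ and $i-i'\equiv\pm1\pmod m$. Then $G$ (which is bipartite) satisfies the Union Closed Conjecture, i.e. each of its two bipartition classes contains a rare vertex.
   Context: A maximal stable set of a graph is a set of pairwise non-adjacent vertices to which no further vertex can be added while remaining pairwise non-adjacent. A vertex is rare if it lies in at most half of the maximal stable sets of the graph. A bipartite graph is said to satisfy the Union Closed Conjecture if each of its two bipartition classes contains a rare vertex. -}

module Defs where

open import Data.Nat using (ℕ; zero; suc; _+_; _*_; _≤_; _∸_)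
import Data.Nat as ℕ
open import Data.Nat.DivMod using (_%_)
open import Data.Fin using (Fin; toℕ; remQuot)
open import Data.Fin.Subset using (Subset; _∈_; _∉_; ⁅_⁆; _∪_; inside; outside)
open import Data.Fin.Subset.Properties using (_∈?_)
open import Data.Fin.Properties using (all?)
open import Data.Vec using ([]; _∷_)
open import Data.Product using (_×_; _,_; proj₁; proj₂; ∃)
open import Data.Sum using (_⊎_)
open import Data.Empty using (⊥)
open import Relation.Nullary using (¬_; Dec; yes; no)
open import Relation.Nullary.Decidable using (_×-dec_; _⊎-dec_; ¬?; _→-dec_)
open import Relation.Binary.PropositionalEquality using (_≡_)

record Graph (N : ℕ) : Set₁ where
  field
    Adj  : Fin N → Fin N → Set
    adj? : ∀ u v → Dec (Adj u v)

module _ {N : ℕ} (G : Graph N) where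
  open Graph G

  Stable : Subset N → Set
  Stable S = ∀ u v → u ∈ S → v ∈ S → ¬ Adj u v

  MaximalStable : Subset N → Set
  MaximalStable S = Stable S × (∀ v → v ∉ S → ¬ Stable (⁅ v ⁆ ∪ S))

  stable? : ∀ S → Dec (Stable S)
  stable? S = all? λ u → all? λ v →
    (u ∈? S) →-dec ((v ∈? S) →-dec ¬? (adj? u v))

  maximalStable? : ∀ S → Dec (MaximalStable S)
  maximalStable? S = stable? S ×-dec
    (all? λ v → ¬? (v ∈? S) →-dec ¬? (stable? (⁅ v ⁆ ∪ S)))

countSubsets : ∀ N (P : Subset N → Set) → (∀ S → Dec (P S)) → ℕ
countSubsets zero P P? with P? []
... | yes _ = 1
... | no  _ = 0
countSubsets (suc N) P P? =
  countSubsets N (λ S → P (outside ∷ S)) (λ S → P? (outside ∷ S)) +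
  countSubsets N (λ S → P (inside ∷ S)) (λ S → P? (inside ∷ S))

module _ {N : ℕ} (G : Graph N) where

  #MSS : ℕ
  #MSS = countSubsets N (MaximalStable G) (maximalStable? G)

  #MSS∋ : Fin N → ℕ
  #MSS∋ v = countSubsets N (λ S → MaximalStable G S × v ∈ S)
                           (λ S → maximalStable? G S ×-dec (v ∈? S))

  Rare : Fin N → Set
  Rare v = 2 * #MSS∋ v ≤ #MSS

CycAdj : (n : ℕ) → Fin n → Fin n → Set
CycAdj zero    a b = ⊥
CycAdj (suc k) a b = (suc (toℕ a) % suc k ≡ toℕ b) ⊎ (suc (toℕ b) % suc k ≡ toℕ a)

cycAdj? : ∀ n a b → Dec (CycAdj n a b)
cycAdj? zero    a b = no λ ()
cycAdj? (suc k) a b = (suc (toℕ a) % suc k ℕ.≟ toℕ b) ⊎-dec (suc (toℕ b) % suc k ℕ.≟ toℕ a)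

-- Coordinates of a vertex.  Vertex (i , j) with 0 ≤ i < m, 0 ≤ j < n
-- is encoded as the element of Fin (m * n) decoded by remQuot n.
row : ∀ m n → Fin (m * n) → Fin m
row m n u = proj₁ (remQuot {m} n u)

col : ∀ m n → Fin (m * n) → Fin n
col m n u = proj₂ (remQuot {m} n u)

TorusAdj : ∀ m n → Fin (m * n) → Fin (m * n) → Set
TorusAdj m n u v =
  (row m n u ≡ row m n v × CycAdj n (col m n u) (col m n v)) ⊎
  (col m n u ≡ col m n v × CycAdj m (row m n u) (row m n v))

torusAdj? : ∀ m n u v → Dec (TorusAdj m n u v)
torusAdj? m n u v =
  ((row m n u Data.Fin.≟ row m n v) ×-dec cycAdj? n (col m n u) (col m n v)) ⊎-dec
  ((col m n u Data.Fin.≟ col m n v) ×-dec cycAdj? m (row m n u) (row m n v))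

Torus : ∀ m n → Graph (m * n)
Torus m n = record { Adj = TorusAdj m n ; adj? = torusAdj? m n }

-- The two bipartition classes (for m, n even): parity of i + j.
EvenClass : ∀ m n → Fin (m * n) → Set
EvenClass m n u = (toℕ (row m n u) + toℕ (col m n u)) % 2 ≡ 0

OddClass : ∀ m n → Fin (m * n) → Set
OddClass m n u = (toℕ (row m n u) + toℕ (col m n u)) % 2 ≡ 1

{-# OPTIONS --safe #-}
-- Shifting the second coordinate, (i , j) ↦ (i , j + 1 mod n), is an automorphism π of
-- C_m × C_n moving every vertex u to a neighbour π u.  Images under π map the maximal stable
-- sets through u injectively to those through π u, and no stable set contains both u and π u,
-- so 2 · #MSS∋ u ≤ #MSS∋ u + #MSS∋ (π u) ≤ #MSS: every vertex is rare.
module Submission where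

open import Data.Fin using (Fin; toℕ; fromℕ<; combine; remQuot; splitAt; join)
open import Data.Fin.Patterns using (0F; 1F)
open import Data.Fin.Permutation
  using (Permutation′; permutation; _⟨$⟩ʳ_; _⟨$⟩ˡ_; flip; inverseˡ; inverseʳ)
open import Data.Fin.Properties
  using (splitAt-join; +↔⊎; injective⇒≤; toℕ-injective; toℕ-fromℕ<; toℕ<n; remQuot-combine; combine-remQuot)
open import Data.Fin.Subset using (Subset; inside; outside; _∈_; _∉_; _⊆_; ⁅_⁆; _∪_)
open import Data.Fin.Subset.Properties using (_∈?_; x∈⁅x⁆; x∈⁅y⁆⇒x≡y; x∈p∪q⁻; x∈p∪q⁺)
open import Data.Nat using (ℕ; zero; suc; _+_; _*_; _≤_; _<_; z≤n; s≤s; NonZero)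
open import Data.Nat.DivMod using (_%_; m%n<n; m<n⇒m%n≡m; m%n%n≡m%n; %-distribˡ-+; [m+n]%n≡m%n)
open import Data.Nat.Properties
  using (+-commutativeSemigroup; ≤-refl; +-mono-≤; +-monoʳ-≤; +-identityʳ; +-suc; module ≤-Reasoning)
open import Data.Product using (_×_; _,_; proj₁; proj₂; ∃; map; swap; uncurry)
open import Data.Sum using (_⊎_; inj₁; inj₂)
import Data.Sum as ⊎
open import Data.Vec using ([]; _∷_; tabulate; lookup)
open import Data.Vec.Properties
  using (∷-injectiveʳ; []=⇒lookup; lookup⇒[]=; lookup∘tabulate; tabulate∘lookup; tabulate-cong)
open import Function using (_∘_; id; Injection)
open import Function.Definitions using (Injective)
open import Function.Properties.Inverse using (↔⇒↣)
open import Relation.Binary.PropositionalEquality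
  using (_≡_; refl; sym; trans; cong; subst; subst₂; module ≡-Reasoning)
open import Relation.Nullary using (yes; no; ¬_; contradiction; _×-dec_)
open import Relation.Unary using (Decidable)
open import Defs
open import Algebra.Properties.CommutativeSemigroup +-commutativeSemigroup using (interchange)

mutual
  enumerate : ∀ {N} {P : Subset N → Set} (P? : Decidable P) → Fin (countSubsets N P P?) → ∃ P
  enumerate {zero} P? i with P? []
  ... | yes p = [] , p
  enumerate {zero} P? () | no _
  enumerate {suc N} P? = enumerate-halves P? ∘ splitAt _

  enumerate-halves : ∀ {N} {P : Subset (suc N) → Set} (P? : Decidable P) →
                     Fin (countSubsets N (P ∘ (outside ∷_)) (P? ∘ (outside ∷_))) ⊎
                     Fin (countSubsets N (P ∘ (inside ∷_)) (P? ∘ (inside ∷_))) → ∃ P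
  enumerate-halves P? (inj₁ i) = map (outside ∷_) id (enumerate (P? ∘ (outside ∷_)) i)
  enumerate-halves P? (inj₂ i) = map (inside ∷_) id (enumerate (P? ∘ (inside ∷_)) i)

mutual
  enumerate-injective : ∀ {N} {P : Subset N → Set} (P? : Decidable P) →
                        Injective _≡_ _≡_ (proj₁ ∘ enumerate P?)
  enumerate-injective {zero} P? {i} {j} _ with P? []
  enumerate-injective {zero} P? {0F} {0F} _ | yes _ = refl
  enumerate-injective {suc N} P? e =
    Injection.injective (↔⇒↣ +↔⊎) (enumerate-halves-injective P? e)

  enumerate-halves-injective : ∀ {N} {P : Subset (suc N) → Set} (P? : Decidable P) →
                               Injective _≡_ _≡_ (proj₁ ∘ enumerate-halves P?)
  enumerate-halves-injective P? {inj₁ i} {inj₁ j} e =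
    cong inj₁ (enumerate-injective (P? ∘ (outside ∷_)) (∷-injectiveʳ e))
  enumerate-halves-injective P? {inj₂ i} {inj₂ j} e =
    cong inj₂ (enumerate-injective (P? ∘ (inside ∷_)) (∷-injectiveʳ e))
  enumerate-halves-injective P? {inj₁ i} {inj₂ j} ()
  enumerate-halves-injective P? {inj₂ i} {inj₁ j} ()

index : ∀ {N} {P : Subset N → Set} (P? : Decidable P) (S : Subset N) → P S →
        Fin (countSubsets N P P?)
index {zero} P? [] p with P? []
... | yes _ = 0F
... | no ¬p = contradiction p ¬p
index {suc N} P? (outside ∷ S) p = join _ _ (inj₁ (index (P? ∘ (outside ∷_)) S p))
index {suc N} P? (inside ∷ S) p = join _ _ (inj₂ (index (P? ∘ (inside ∷_)) S p))

enumerate-index : ∀ {N} {P : Subset N → Set} (P? : Decidable P) (S : Subset N) (p : P S) →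
                  proj₁ (enumerate P? (index P? S p)) ≡ S
enumerate-index {zero} P? [] p with P? []
... | yes _ = refl
... | no ¬p = contradiction p ¬p
enumerate-index {suc N} P? (outside ∷ S) p =
  trans (cong (proj₁ ∘ enumerate-halves P?) (splitAt-join _ _ (inj₁ (index _ S p))))
        (cong (outside ∷_) (enumerate-index (P? ∘ (outside ∷_)) S p))
enumerate-index {suc N} P? (inside ∷ S) p =
  trans (cong (proj₁ ∘ enumerate-halves P?) (splitAt-join _ _ (inj₂ (index _ S p))))
        (cong (inside ∷_) (enumerate-index (P? ∘ (inside ∷_)) S p))

countSubsets-mono-injective : ∀ {N} {P Q : Subset N → Set} (P? : Decidable P) (Q? : Decidable Q)
                              (f : Subset N → Subset N) → Injective _≡_ _≡_ f →
                              (∀ {S} → P S → Q (f S)) →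
                              countSubsets N P P? ≤ countSubsets N Q Q?
countSubsets-mono-injective P? Q? f f-injective P⇒Q∘f = injective⇒≤ transfer-injective
  where
  transfer : Fin (countSubsets _ _ P?) → Fin (countSubsets _ _ Q?)
  transfer i = index Q? (f (proj₁ (enumerate P? i))) (P⇒Q∘f (proj₂ (enumerate P? i)))

  transfer-injective : Injective _≡_ _≡_ transfer
  transfer-injective {i} {j} e = enumerate-injective P? (f-injective (begin
    f (proj₁ (enumerate P? i))                 ≡⟨ enumerate-index Q? _ _ ⟨
    proj₁ (enumerate Q? (transfer i))          ≡⟨ cong (proj₁ ∘ enumerate Q?) e ⟩
    proj₁ (enumerate Q? (transfer j))          ≡⟨ enumerate-index Q? _ _ ⟩
    f (proj₁ (enumerate P? j))                 ∎))
    where open ≡-Reasoning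

countSubsets-disjoint-+ : ∀ {N} {P Q R : Subset N → Set}
                          (P? : Decidable P) (Q? : Decidable Q) (R? : Decidable R) →
                          (∀ {S} → P S → R S) → (∀ {S} → Q S → R S) →
                          (∀ {S} → P S → ¬ Q S) →
                          countSubsets N P P? + countSubsets N Q Q? ≤ countSubsets N R R?
countSubsets-disjoint-+ {zero} P? Q? R? P⇒R Q⇒R disjoint with P? [] | Q? [] | R? []
... | yes p | yes q | _     = contradiction q (disjoint p)
... | yes _ | no _  | yes _ = ≤-refl
... | no _  | yes _ | yes _ = ≤-refl
... | yes p | no _  | no ¬r = contradiction (P⇒R p) ¬r
... | no _  | yes q | no ¬r = contradiction (Q⇒R q) ¬r
... | no _  | no _  | _     = z≤n
countSubsets-disjoint-+ {suc N} P? Q? R? P⇒R Q⇒R disjoint = begin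
  (p₀ + p₁) + (q₀ + q₁) ≡⟨ interchange p₀ p₁ q₀ q₁ ⟩
  (p₀ + q₀) + (p₁ + q₁) ≤⟨ +-mono-≤ (half outside) (half inside) ⟩
  countSubsets (suc N) _ R? ∎
  where
  open ≤-Reasoning
  half : ∀ b → countSubsets N _ (P? ∘ (b ∷_)) + countSubsets N _ (Q? ∘ (b ∷_)) ≤
               countSubsets N _ (R? ∘ (b ∷_))
  half b =
    countSubsets-disjoint-+ (P? ∘ (b ∷_)) (Q? ∘ (b ∷_)) (R? ∘ (b ∷_)) P⇒R Q⇒R disjoint
  p₀ p₁ q₀ q₁ : ℕ
  p₀ = countSubsets N _ (P? ∘ (outside ∷_))
  p₁ = countSubsets N _ (P? ∘ (inside ∷_))
  q₀ = countSubsets N _ (Q? ∘ (outside ∷_))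
  q₁ = countSubsets N _ (Q? ∘ (inside ∷_))

preimage : ∀ {M N} → (Fin M → Fin N) → Subset N → Subset M
preimage f S = tabulate (lookup S ∘ f)

module _ {M N} (f : Fin M → Fin N) {S : Subset N} where

  ∈-preimage⁺ : ∀ {x} → f x ∈ S → x ∈ preimage f S
  ∈-preimage⁺ {x} fx∈S = lookup⇒[]= x _ (trans (lookup∘tabulate _ x) ([]=⇒lookup fx∈S))

  ∈-preimage⁻ : ∀ {x} → x ∈ preimage f S → f x ∈ S
  ∈-preimage⁻ {x} x∈f⁻¹S =
    lookup⇒[]= (f x) S (trans (sym (lookup∘tabulate _ x)) ([]=⇒lookup x∈f⁻¹S))

preimage-inverse : ∀ {M N} {f : Fin M → Fin N} {g : Fin N → Fin M} →
                   (∀ x → g (f x) ≡ x) → ∀ S → preimage f (preimage g S) ≡ S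
preimage-inverse {f = f} {g} g∘f≡id S = begin
  tabulate (lookup (tabulate (lookup S ∘ g)) ∘ f)
    ≡⟨ tabulate-cong (λ x → lookup∘tabulate _ (f x)) ⟩
  tabulate (lookup S ∘ g ∘ f)
    ≡⟨ tabulate-cong (cong (lookup S) ∘ g∘f≡id) ⟩
  tabulate (lookup S)
    ≡⟨ tabulate∘lookup S ⟩
  S ∎
  where open ≡-Reasoning

preimage-injective : ∀ {N} (π : Permutation′ N) → Injective _≡_ _≡_ (preimage (π ⟨$⟩ʳ_))
preimage-injective π {S} {T} e = begin
  S                                          ≡⟨ π⁻¹∘π S ⟨
  preimage (π ⟨$⟩ˡ_) (preimage (π ⟨$⟩ʳ_) S) ≡⟨ cong (preimage (π ⟨$⟩ˡ_)) e ⟩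
  preimage (π ⟨$⟩ˡ_) (preimage (π ⟨$⟩ʳ_) T) ≡⟨ π⁻¹∘π T ⟩
  T                                          ∎
  where
  open ≡-Reasoning
  π⁻¹∘π : ∀ S → preimage (π ⟨$⟩ˡ_) (preimage (π ⟨$⟩ʳ_) S) ≡ S
  π⁻¹∘π = preimage-inverse {f = π ⟨$⟩ˡ_} (λ _ → inverseʳ π)

module _ {N : ℕ} (G : Graph N) where
  open Graph G

  Homomorphism : (Fin N → Fin N) → Set
  Homomorphism f = ∀ {x y} → Adj x y → Adj (f x) (f y)

  IsAutomorphism : Permutation′ N → Set
  IsAutomorphism π = Homomorphism (π ⟨$⟩ʳ_) × Homomorphism (π ⟨$⟩ˡ_)

  stable-⊆ : ∀ {S T} → S ⊆ T → Stable G T → Stable G S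
  stable-⊆ S⊆T T-stable u v u∈S v∈S = T-stable u v (S⊆T u∈S) (S⊆T v∈S)

  preimage-stable : ∀ {f S} → Homomorphism f → Stable G S → Stable G (preimage f S)
  preimage-stable {f} f-hom S-stable u v u∈ v∈ adj =
    S-stable (f u) (f v) (∈-preimage⁻ f u∈) (∈-preimage⁻ f v∈) (f-hom adj)

  preimage-maximalStable : ∀ {S} (π : Permutation′ N) → IsAutomorphism π →
                           MaximalStable G S → MaximalStable G (preimage (π ⟨$⟩ʳ_) S)
  preimage-maximalStable {S} π (π-hom , π⁻¹-hom) (S-stable , S-maximal) =
    preimage-stable π-hom S-stable , maximal
    where
    extension-⊆ : ∀ v →
                  ⁅ π ⟨$⟩ʳ v ⁆ ∪ S ⊆ preimage (π ⟨$⟩ˡ_) (⁅ v ⁆ ∪ preimage (π ⟨$⟩ʳ_) S)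
    extension-⊆ v {x} x∈ =
      ∈-preimage⁺ (π ⟨$⟩ˡ_)
        (x∈p∪q⁺ (⊎.map in-singleton in-S (x∈p∪q⁻ ⁅ π ⟨$⟩ʳ v ⁆ S x∈)))
      where
      in-singleton : x ∈ ⁅ π ⟨$⟩ʳ v ⁆ → π ⟨$⟩ˡ x ∈ ⁅ v ⁆
      in-singleton x∈⁅πv⁆ rewrite x∈⁅y⁆⇒x≡y _ x∈⁅πv⁆ | inverseˡ π {v} = x∈⁅x⁆ v
      in-S : x ∈ S → π ⟨$⟩ˡ x ∈ preimage (π ⟨$⟩ʳ_) S
      in-S x∈S = ∈-preimage⁺ (π ⟨$⟩ʳ_) (subst (_∈ S) (sym (inverseʳ π)) x∈S)

    -- If ⁅ v ⁆ ∪ π⁻¹ S were stable, so would be its π-image, which contains ⁅ π v ⁆ ∪ S.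
    maximal : ∀ v → v ∉ preimage (π ⟨$⟩ʳ_) S →
              ¬ Stable G (⁅ v ⁆ ∪ preimage (π ⟨$⟩ʳ_) S)
    maximal v v∉ extension-stable =
      S-maximal (π ⟨$⟩ʳ v) (v∉ ∘ ∈-preimage⁺ (π ⟨$⟩ʳ_))
        (stable-⊆ (extension-⊆ v) (preimage-stable π⁻¹-hom extension-stable))

  #MSS∋-≤-automorphism : (π : Permutation′ N) → IsAutomorphism π →
                         ∀ u → #MSS∋ G u ≤ #MSS∋ G (π ⟨$⟩ʳ u)
  #MSS∋-≤-automorphism π π-automorphism u =
    countSubsets-mono-injective _ _ (preimage (π ⟨$⟩ˡ_)) (preimage-injective (flip π))
      λ (S-mss , u∈S) →
        preimage-maximalStable (flip π) (swap π-automorphism) S-mss ,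
        ∈-preimage⁺ (π ⟨$⟩ˡ_) (subst (_∈ _) (sym (inverseˡ π)) u∈S)

  adjacent⇒#MSS∋+#MSS∋≤#MSS : ∀ {u v} → Adj u v → #MSS∋ G u + #MSS∋ G v ≤ #MSS G
  adjacent⇒#MSS∋+#MSS∋≤#MSS {u} {v} adj =
    countSubsets-disjoint-+ (mss∋? u) (mss∋? v) (maximalStable? G) proj₁ proj₁
      λ (S-mss , u∈S) (_ , v∈S) → proj₁ S-mss u v u∈S v∈S adj
    where
    mss∋? : ∀ w → Decidable (λ S → MaximalStable G S × w ∈ S)
    mss∋? w S = maximalStable? G S ×-dec (w ∈? S)

  automorphic-neighbour⇒rare : (π : Permutation′ N) → IsAutomorphism π →
                               ∀ u → Adj u (π ⟨$⟩ʳ u) → Rare G u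
  automorphic-neighbour⇒rare π π-aut u adj = begin
    2 * #MSS∋ G u                     ≡⟨ cong (#MSS∋ G u +_) (+-identityʳ _) ⟩
    #MSS∋ G u + #MSS∋ G u             ≤⟨ +-monoʳ-≤ _ (#MSS∋-≤-automorphism π π-aut u) ⟩
    #MSS∋ G u + #MSS∋ G (π ⟨$⟩ʳ u)    ≤⟨ adjacent⇒#MSS∋+#MSS∋≤#MSS adj ⟩
    #MSS G                            ∎
    where open ≤-Reasoning

[m%d+n]%d≡[m+n]%d : ∀ m n d .{{_ : NonZero d}} → (m % d + n) % d ≡ (m + n) % d
[m%d+n]%d≡[m+n]%d m n d = begin
  (m % d + n) % d         ≡⟨ %-distribˡ-+ (m % d) n d ⟩
  (m % d % d + n % d) % d ≡⟨ cong (λ x → (x + n % d) % d) (m%n%n≡m%n m d) ⟩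
  (m % d + n % d) % d     ≡⟨ %-distribˡ-+ m n d ⟨
  (m + n) % d             ∎
  where open ≡-Reasoning

[m+n%d]%d≡[m+n]%d : ∀ m n d .{{_ : NonZero d}} → (m + n % d) % d ≡ (m + n) % d
[m+n%d]%d≡[m+n]%d m n d = begin
  (m + n % d) % d         ≡⟨ %-distribˡ-+ m (n % d) d ⟩
  (m % d + n % d % d) % d ≡⟨ cong (λ x → (m % d + x) % d) (m%n%n≡m%n n d) ⟩
  (m % d + n % d) % d     ≡⟨ %-distribˡ-+ m n d ⟨
  (m + n) % d             ∎
  where open ≡-Reasoning

module Cycle (k : ℕ) where

  next : Fin (suc k) → Fin (suc k)
  next a = fromℕ< (m%n<n (suc (toℕ a)) (suc k))

  -- Adding k rather than subtracting 1 avoids truncated subtraction.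
  prev : Fin (suc k) → Fin (suc k)
  prev a = fromℕ< (m%n<n (toℕ a + k) (suc k))

  toℕ-next : ∀ a → toℕ (next a) ≡ suc (toℕ a) % suc k
  toℕ-next a = toℕ-fromℕ< (m%n<n (suc (toℕ a)) (suc k))

  toℕ-prev : ∀ a → toℕ (prev a) ≡ (toℕ a + k) % suc k
  toℕ-prev a = toℕ-fromℕ< (m%n<n (toℕ a + k) (suc k))

  suc[a+k]%[1+k]≡a : ∀ a → a < suc k → suc (a + k) % suc k ≡ a
  suc[a+k]%[1+k]≡a a a<1+k = begin
    suc (a + k) % suc k ≡⟨ cong (_% suc k) (+-suc a k) ⟨
    (a + suc k) % suc k ≡⟨ [m+n]%n≡m%n a (suc k) ⟩
    a % suc k           ≡⟨ m<n⇒m%n≡m a<1+k ⟩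
    a                   ∎
    where open ≡-Reasoning

  next-prev : ∀ a → next (prev a) ≡ a
  next-prev a = toℕ-injective (begin
    toℕ (next (prev a))               ≡⟨ toℕ-next (prev a) ⟩
    suc (toℕ (prev a)) % suc k        ≡⟨ cong (λ x → suc x % suc k) (toℕ-prev a) ⟩
    (1 + (toℕ a + k) % suc k) % suc k ≡⟨ [m+n%d]%d≡[m+n]%d 1 (toℕ a + k) (suc k) ⟩
    suc (toℕ a + k) % suc k           ≡⟨ suc[a+k]%[1+k]≡a (toℕ a) (toℕ<n a) ⟩
    toℕ a                             ∎)
    where open ≡-Reasoning

  prev-next : ∀ a → prev (next a) ≡ a
  prev-next a = toℕ-injective (begin
    toℕ (prev (next a))                  ≡⟨ toℕ-prev (next a) ⟩
    (toℕ (next a) + k) % suc k           ≡⟨ cong (λ x → (x + k) % suc k) (toℕ-next a) ⟩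
    (suc (toℕ a) % suc k + k) % suc k    ≡⟨ [m%d+n]%d≡[m+n]%d (suc (toℕ a)) k (suc k) ⟩
    suc (toℕ a + k) % suc k              ≡⟨ suc[a+k]%[1+k]≡a (toℕ a) (toℕ<n a) ⟩
    toℕ a                                ∎)
    where open ≡-Reasoning

  rotation : Permutation′ (suc k)
  rotation = permutation next prev next-prev prev-next

  cycAdj⇒next : ∀ {a b} → CycAdj (suc k) a b → next a ≡ b ⊎ next b ≡ a
  cycAdj⇒next {a} {b} =
    ⊎.map (toℕ-injective ∘ trans (toℕ-next a)) (toℕ-injective ∘ trans (toℕ-next b))

  next⇒cycAdj : ∀ {a b} → next a ≡ b ⊎ next b ≡ a → CycAdj (suc k) a b
  next⇒cycAdj {a} {b} =
    ⊎.map (trans (sym (toℕ-next a)) ∘ cong toℕ) (trans (sym (toℕ-next b)) ∘ cong toℕ)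

  cycAdj-next : ∀ a → CycAdj (suc k) a (next a)
  cycAdj-next a = next⇒cycAdj (inj₁ refl)

  cycAdj-preserved : ∀ {f : Fin (suc k) → Fin (suc k)} → (∀ a → f (next a) ≡ next (f a)) →
                     ∀ {a b} → CycAdj (suc k) a b → CycAdj (suc k) (f a) (f b)
  cycAdj-preserved {f} f-next {a} {b} =
    next⇒cycAdj {f a} {f b} ∘ ⊎.map (commute a b) (commute b a) ∘ cycAdj⇒next {a} {b}
    where
    commute : ∀ a b → next a ≡ b → next (f a) ≡ f b
    commute a _ refl = sym (f-next a)

module _ (m : ℕ) {n : ℕ} where

  mapColumn : (Fin n → Fin n) → Fin (m * n) → Fin (m * n)
  mapColumn f u = combine (row m n u) (f (col m n u))

  remQuot-mapColumn : ∀ f u → remQuot {m} n (mapColumn f u) ≡ (row m n u , f (col m n u))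
  remQuot-mapColumn f u = remQuot-combine _ _

  mapColumn-inverse : ∀ {f g} → (∀ j → f (g j) ≡ j) → ∀ u → mapColumn f (mapColumn g u) ≡ u
  mapColumn-inverse {f} {g} f∘g≡id u = begin
    uncurry combine (map id f (remQuot {m} n (mapColumn g u)))
      ≡⟨ cong (uncurry combine ∘ map id f) (remQuot-mapColumn g u) ⟩
    combine (row m n u) (f (g (col m n u)))
      ≡⟨ cong (combine (row m n u)) (f∘g≡id (col m n u)) ⟩
    uncurry combine (remQuot {m} n u)
      ≡⟨ combine-remQuot {m} n u ⟩
    u ∎
    where open ≡-Reasoning

  onColumns : Permutation′ n → Permutation′ (m * n)
  onColumns ρ = permutation (mapColumn (ρ ⟨$⟩ʳ_)) (mapColumn (ρ ⟨$⟩ˡ_))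
    (mapColumn-inverse {ρ ⟨$⟩ʳ_} (λ _ → inverseʳ ρ))
    (mapColumn-inverse {ρ ⟨$⟩ˡ_} (λ _ → inverseˡ ρ))

module _ (m k : ℕ) where
  open Cycle k

  -- TorusAdj m (suc k) u v unfolds to CoordinateAdj (remQuot (suc k) u) (remQuot (suc k) v).
  CoordinateAdj : Fin m × Fin (suc k) → Fin m × Fin (suc k) → Set
  CoordinateAdj (i , j) (i′ , j′) =
    (i ≡ i′ × CycAdj (suc k) j j′) ⊎ (j ≡ j′ × CycAdj m i i′)

  mapColumn-homomorphism : ∀ {f} → (∀ a → f (next a) ≡ next (f a)) →
                           Homomorphism (Torus m (suc k)) (mapColumn m f)
  mapColumn-homomorphism {f} f-next {u} {v} =
    subst₂ CoordinateAdj (sym (remQuot-mapColumn m f u)) (sym (remQuot-mapColumn m f v)) ∘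
    ⊎.map (map id (cycAdj-preserved {f} f-next)) (map (cong f) id)

  rotateColumns-automorphism : IsAutomorphism (Torus m (suc k)) (onColumns m rotation)
  rotateColumns-automorphism =
    mapColumn-homomorphism {next} (λ _ → refl) ,
    mapColumn-homomorphism {prev} (λ a → trans (prev-next a) (sym (next-prev a)))

  adjacent-rotateColumns : ∀ u → TorusAdj m (suc k) u (onColumns m rotation ⟨$⟩ʳ u)
  adjacent-rotateColumns u =
    subst (CoordinateAdj (remQuot {m} (suc k) u)) (sym (remQuot-mapColumn m next u))
      (inj₁ (refl , cycAdj-next (col m (suc k) u)))

  torus-rare : ∀ u → Rare (Torus m (suc k)) u
  torus-rare u = automorphic-neighbour⇒rare (Torus m (suc k))
    (onColumns m rotation) rotateColumns-automorphism u (adjacent-rotateColumns u)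

parity-combine : ∀ {m n} (i : Fin m) (j : Fin n) →
                 (toℕ (row m n (combine i j)) + toℕ (col m n (combine i j))) % 2 ≡
                 (toℕ i + toℕ j) % 2
parity-combine i j = cong (λ (i , j) → (toℕ i + toℕ j) % 2) (remQuot-combine i j)

proposition4 : ∀ m n → 4 ≤ m → 4 ≤ n → m % 2 ≡ 0 → n % 2 ≡ 0 →
    (∃ λ u → EvenClass m n u × Rare (Torus m n) u) ×
    (∃ λ v → OddClass m n v × Rare (Torus m n) v)
proposition4 m@(suc _) n@(suc k) (s≤s _) (s≤s (s≤s _)) _ _ =
  (combine {m} {n} 0F 0F , parity-combine {m} {n} 0F 0F , torus-rare m k _) ,
  (combine {m} {n} 0F 1F , parity-combine {m} {n} 0F 1F , torus-rare m k _)
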